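{- Let $h:A\to\mathbb{N}$ be an increasing function with $A\subseteq\mathbb{N}$ and $h(a)>a$ for all $a\in A$, and let $(h_\alpha)_{\alpha<\epsilon_0}$ be its Hardy-like hierarchy. Let $\alpha,\beta<\epsilon_0$ with $\beta>0$, and let $x>0$ be an integer. If $h_{\beta\oplus\alpha}(x)$ is defined, then $h_{\{\beta\}(x)\oplus\alpha}(h(x))$ is defined and $$h_{\beta\oplus\alpha}(x)=h_{\{\beta\oplus\alpha\}(x)}(h(x))\geq h_{\{\beta\}(x)\oplus\alpha}(h(x)).$$
   Context: $\oplus$ is the natural (Hessenberg) sum of ordinals (coefficient-wise sum in Cantor normal form). Fundamental sequences: $\{0\}(x)=0$; for $\alpha\neq0$ write $\alpha=\delta+\omega^\gamma$ in Cantor normal form with $\omega^\gamma$ the last term; then $\{\alpha\}(x)=\delta$ if $\gamma=0$, $\delta+\omega^{\gamma'}\cdot x$ if $\gamma=\gamma'+1$, $\delta+\omega^{\{\gamma\}(x)}$ if $\gamma$ is a limit. Hardy-like hierarchy of partial functions: $h_0(x)=x$ for all $x\in\mathbb{N}$; for $\alpha>0$, $h_\alpha(x)=h_{\{\alpha\}(x)}(h(x))$ if $x\in\operatorname{dom}h$ and $h(x)\in\operatorname{dom}h_{\{\alpha\}(x)}$, and $h_\alpha(x)$ is undefined otherwise. -}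

module Defs where

open import Data.Nat using (ℕ; zero; suc; _<_)
open import Data.Maybe using (Maybe; just; nothing)
open import Data.Unit using (⊤)
open import Relation.Binary.PropositionalEquality using (_≡_; _≢_)

-- Ordinals below ε₀ in Cantor normal form:
--   𝟎            is the ordinal 0,
--   ω^ a + b     is  ω^a + b.
-- Well-formedness (non-increasing exponents, recursively) is the predicate WF.
data Ord : Set where
  𝟎    : Ord
  ω^_+_ : Ord → Ord → Ord

infixr 30 ω^_+_

data Cmp : Set where
  lt eq gt : Cmp

compare : Ord → Ord → Cmp
compare 𝟎 𝟎 = eq
compare 𝟎 (ω^ _ + _) = lt
compare (ω^ _ + _) 𝟎 = gt
compare (ω^ a + b) (ω^ c + d) with compare a c
... | lt = lt
... | gt = gt
... | eq = compare b d

_≤ₒ_ : Ord → Ord → Set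
a ≤ₒ b = compare a b ≢ gt

LeadLE : Ord → Ord → Set
LeadLE 𝟎 a = ⊤
LeadLE (ω^ c + _) a = c ≤ₒ a

data WF : Ord → Set where
  wf𝟎 : WF 𝟎
  wfω : ∀ {a b} → WF a → WF b → LeadLE b a → WF (ω^ a + b)

-- Natural (Hessenberg) sum: merge of the two CNF term lists.
infixl 20 _⊕_
_⊕_ : Ord → Ord → Ord
𝟎 ⊕ b = b
(ω^ a + a') ⊕ b = go b
  where
  pick : Cmp → Ord → Ord → Ord → Ord
  pick lt c c' r = ω^ c + r
  pick eq c c' r = ω^ a + (a' ⊕ (ω^ c + c'))
  pick gt c c' r = ω^ a + (a' ⊕ (ω^ c + c'))
  go : Ord → Ord
  go 𝟎 = ω^ a + a'
  go (ω^ c + c') = pick (compare a c) c c' (go c')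

ω^_·_ : Ord → ℕ → Ord
ω^ a · zero = 𝟎
ω^ a · suc n = ω^ a + (ω^ a · n)

data Kind : Set where
  zeroK : Kind
  succK : Ord → Kind
  limK  : Kind

kind : Ord → Kind
kind 𝟎 = zeroK
kind (ω^ 𝟎 + 𝟎) = succK 𝟎
kind (ω^ (ω^ _ + _) + 𝟎) = limK
kind (ω^ a + b@(ω^ _ + _)) with kind b
... | zeroK = zeroK
... | succK b' = succK (ω^ a + b')
... | limK = limK

-- Fundamental sequences {α}(x): with α = δ + ω^γ (last term ω^γ),
--   {α}(x) = δ             if γ = 0
--          = δ + ω^γ'·x    if γ = γ' + 1
--          = δ + ω^{γ}(x)  if γ is a limit.
fs : Ord → ℕ → Ord
fs 𝟎 x = 𝟎
fs (ω^ a + 𝟎) x with kind a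
... | zeroK = 𝟎
... | succK a' = ω^ a' · x
... | limK = ω^ (fs a x) + 𝟎
fs (ω^ a + b@(ω^ _ + _)) x = ω^ a + fs b x

-- A partial function h : A → ℕ with A ⊆ ℕ, represented as ℕ → Maybe ℕ
-- (A = {x | h x ≡ just _}).
PFun : Set
PFun = ℕ → Maybe ℕ

Increasing : PFun → Set
Increasing h = ∀ a b ya yb → h a ≡ just ya → h b ≡ just yb → a < b → ya < yb

Expansive : PFun → Set
Expansive h = ∀ a ya → h a ≡ just ya → a < ya

-- Graph of the Hardy-like hierarchy:  Hardy h α x y  means  h_α(x) is defined and equals y.
--   h_0(x) = x ;  for α > 0, h_α(x) = h_{{α}(x)}(h(x)) when x ∈ dom h and h(x) ∈ dom h_{{α}(x)}.
data Hardy (h : PFun) : Ord → ℕ → ℕ → Set where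
  hardy𝟎 : ∀ x → Hardy h 𝟎 x x
  hardyω : ∀ {a b x hx y} → h x ≡ just hx →
           Hardy h (fs (ω^ a + b) x) hx y → Hardy h (ω^ a + b) x y

{-# OPTIONS --safe #-}
-- Write β = β₀ + ω^b with ω^b its last term, and split α into its terms above b, k copies of
-- ω^b and a tail μ of terms below b. With Γ = β₀ ⊕ (terms above b) this gives
--   β ⊕ α = Γ + ω^b·k + ω^b + μ   and   {β}(x) ⊕ α = Γ + ω^b·k + ({ω^b}(x) ⊕ μ),
-- so everything happens in the block ω^b + μ. There, with y = h_μ(x) ≥ x + size μ, we have
-- h_{ω^b+μ}(x) = h_{{ω^b}(y)}(h y), and {ω^b}(y) reaches {ω^b}(x) ⊕ μ by repeatedly taking
-- y-th fundamental sequences, since y bounds both the number of terms and the sizes of the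
-- terms of μ. Two monotonicity facts, proved together by induction on the number of h-steps,
-- finish the proof: h_γ(u) ≤ h_γ(v) when v lies on the h-orbit of u, and h_γ(u) ≤ h_δ(u) when
-- γ is reached from δ by iterating fundamental sequences at a fixed argument p ≤ u (this uses
-- the Bachmann property: {δ}(q) reaches {δ}(p) in this way when p ≤ q). Every value of h
-- consulted lies on the h-orbit of x, so the hypothesis that h is increasing is never needed.

module Submission where

open import Defs
open import Data.Nat using (ℕ; zero; suc; _<_; _≤_; _+_; _*_; z≤n; s≤s)
open import Data.Nat.Properties
open import Data.Maybe using (just)
open import Data.Maybe.Properties using (just-injective)
open import Data.Product using (Σ; _×_; _,_; proj₂)
open import Data.Sum using (_⊎_; inj₁; inj₂)
open import Data.Empty using (⊥; ⊥-elim)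
open import Data.Unit using (⊤; tt)
open import Relation.Nullary using (¬_)
open import Relation.Binary.Construct.Closure.ReflexiveTransitive using (Star; ε; _◅_; _◅◅_)
open import Relation.Binary.PropositionalEquality
  using (_≡_; _≢_; refl; sym; trans; cong; cong₂; subst; subst₂; module ≡-Reasoning)

-- Comparison of Cantor normal forms

lex : Cmp → Cmp → Cmp
lex lt _ = lt
lex eq c = c
lex gt _ = gt

swap : Cmp → Cmp
swap lt = gt
swap eq = eq
swap gt = lt

compare-ω^ : ∀ a b c d → compare (ω^ a + b) (ω^ c + d) ≡ lex (compare a c) (compare b d)
compare-ω^ a b c d with compare a c
... | lt = refl
... | eq = refl
... | gt = refl

compare-refl : ∀ a → compare a a ≡ eq
compare-refl 𝟎 = refl
compare-refl (ω^ a + b) rewrite compare-ω^ a b a b | compare-refl a = compare-refl b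

compare-swap : ∀ a b → compare b a ≡ swap (compare a b)
compare-swap 𝟎 𝟎 = refl
compare-swap 𝟎 (ω^ _ + _) = refl
compare-swap (ω^ _ + _) 𝟎 = refl
compare-swap (ω^ a + b) (ω^ c + d)
  rewrite compare-ω^ a b c d | compare-ω^ c d a b | compare-swap a c | compare-swap b d
  with compare a c
... | lt = refl
... | eq = refl
... | gt = refl

compare≡eq⇒≡ : ∀ a b → compare a b ≡ eq → a ≡ b
compare≡eq⇒≡ 𝟎 𝟎 _ = refl
compare≡eq⇒≡ (ω^ a + b) (ω^ c + d) e rewrite compare-ω^ a b c d with compare a c in ac
... | eq = cong₂ ω^_+_ (compare≡eq⇒≡ a c ac) (compare≡eq⇒≡ b d e)

-- A record rather than `compare a b ≡ lt`, so that a and b can be inferred.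
record _<ₒ_ (a b : Ord) : Set where
  constructor mk<ₒ
  field compare≡lt : compare a b ≡ lt

infix 4 _<ₒ_ _≼_

-- A positive counterpart of `_≤ₒ_`, which is `compare a b ≢ gt`.
_≼_ : Ord → Ord → Set
a ≼ b = a <ₒ b ⊎ a ≡ b

𝟎<ω^ : ∀ {a b} → 𝟎 <ₒ ω^ a + b
𝟎<ω^ = mk<ₒ refl

≮𝟎 : ∀ {a} → ¬ a <ₒ 𝟎
≮𝟎 {𝟎} (mk<ₒ ())
≮𝟎 {ω^ _ + _} (mk<ₒ ())

𝟎≼ : ∀ a → 𝟎 ≼ a
𝟎≼ 𝟎 = inj₂ refl
𝟎≼ (ω^ _ + _) = inj₁ 𝟎<ω^

<ₒ-head : ∀ {a c} b d → a <ₒ c → ω^ a + b <ₒ ω^ c + d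
<ₒ-head {a} {c} b d (mk<ₒ p) = mk<ₒ (trans (compare-ω^ a b c d) (cong (λ o → lex o (compare b d)) p))

<ₒ-tail : ∀ a {b d} → b <ₒ d → ω^ a + b <ₒ ω^ a + d
<ₒ-tail a {b} {d} (mk<ₒ p) =
  mk<ₒ (trans (compare-ω^ a b a d) (trans (cong (λ o → lex o (compare b d)) (compare-refl a)) p))

≼-tail : ∀ a {b d} → b ≼ d → ω^ a + b ≼ ω^ a + d
≼-tail a (inj₁ b<d) = inj₁ (<ₒ-tail a b<d)
≼-tail a (inj₂ refl) = inj₂ refl

<ₒ-ω^⁻ : ∀ {a b c d} → ω^ a + b <ₒ ω^ c + d → a <ₒ c ⊎ (a ≡ c × b <ₒ d)
<ₒ-ω^⁻ {a} {b} {c} {d} (mk<ₒ p) rewrite compare-ω^ a b c d with compare a c in ac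
... | lt = inj₁ (mk<ₒ ac)
... | eq = inj₂ (compare≡eq⇒≡ a c ac , mk<ₒ p)

<ₒ-irrefl : ∀ {a} → ¬ a <ₒ a
<ₒ-irrefl {a} (mk<ₒ p) with trans (sym (compare-refl a)) p
... | ()

<ₒ-irrefl′ : ∀ {a b} → a ≡ b → ¬ a <ₒ b
<ₒ-irrefl′ refl = <ₒ-irrefl

<ₒ-asym : ∀ {a b} → a <ₒ b → ¬ b <ₒ a
<ₒ-asym {a} {b} (mk<ₒ p) (mk<ₒ q) with trans (sym q) (trans (compare-swap a b) (cong swap p))
... | ()

<ₒ-trans : ∀ {a b c} → a <ₒ b → b <ₒ c → a <ₒ c
<ₒ-trans {c = 𝟎} _ b<c = ⊥-elim (≮𝟎 b<c)
<ₒ-trans {b = 𝟎} a<b _ = ⊥-elim (≮𝟎 a<b)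
<ₒ-trans {𝟎} {ω^ _ + _} {ω^ _ + _} _ _ = 𝟎<ω^
<ₒ-trans {ω^ _ + a₂} {ω^ _ + _} {ω^ _ + c₂} a<b b<c with <ₒ-ω^⁻ a<b | <ₒ-ω^⁻ b<c
... | inj₁ p | inj₁ q = <ₒ-head a₂ c₂ (<ₒ-trans p q)
... | inj₁ p | inj₂ (refl , _) = <ₒ-head a₂ c₂ p
... | inj₂ (refl , _) | inj₁ q = <ₒ-head a₂ c₂ q
... | inj₂ (refl , p) | inj₂ (refl , q) = <ₒ-tail _ (<ₒ-trans p q)

<ₒ-≼-trans : ∀ {a b c} → a <ₒ b → b ≼ c → a <ₒ c
<ₒ-≼-trans p (inj₁ q) = <ₒ-trans p q
<ₒ-≼-trans p (inj₂ refl) = p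

≼-<ₒ-trans : ∀ {a b c} → a ≼ b → b <ₒ c → a <ₒ c
≼-<ₒ-trans (inj₁ p) q = <ₒ-trans p q
≼-<ₒ-trans (inj₂ refl) q = q

≼-trans : ∀ {a b c} → a ≼ b → b ≼ c → a ≼ c
≼-trans p (inj₁ q) = inj₁ (≼-<ₒ-trans p q)
≼-trans p (inj₂ refl) = p

≼-refl : ∀ {a} → a ≼ a
≼-refl = inj₂ refl

≤ₒ⇒≼ : ∀ {a b} → a ≤ₒ b → a ≼ b
≤ₒ⇒≼ {a} {b} p with compare a b in e
... | lt = inj₁ (mk<ₒ e)
... | eq = inj₂ (compare≡eq⇒≡ a b e)
... | gt = ⊥-elim (p refl)

≼⇒≤ₒ : ∀ {a b} → a ≼ b → a ≤ₒ b
≼⇒≤ₒ (inj₁ (mk<ₒ p)) q with trans (sym p) q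
... | ()
≼⇒≤ₒ {a} (inj₂ refl) q with trans (sym (compare-refl a)) q
... | ()

<ₒ-or-≽ : ∀ a c → a <ₒ c ⊎ c ≼ a
<ₒ-or-≽ a c with compare a c in e
... | lt = inj₁ (mk<ₒ e)
... | eq = inj₂ (inj₂ (sym (compare≡eq⇒≡ a c e)))
... | gt = inj₂ (inj₁ (mk<ₒ (trans (compare-swap a c) (cong swap e))))

-- Ordinals as lists of exponents

infixr 25 _++ₒ_
_++ₒ_ : Ord → Ord → Ord
𝟎 ++ₒ τ = τ
(ω^ a + ρ) ++ₒ τ = ω^ a + (ρ ++ₒ τ)

++ₒ-identityʳ : ∀ ρ → ρ ++ₒ 𝟎 ≡ ρ
++ₒ-identityʳ 𝟎 = refl
++ₒ-identityʳ (ω^ a + ρ) = cong (ω^ a +_) (++ₒ-identityʳ ρ)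

NonZeroₒ : Ord → Set
NonZeroₒ 𝟎 = ⊥
NonZeroₒ (ω^ _ + _) = ⊤

≢𝟎⇒nonZero : ∀ {β} → β ≢ 𝟎 → NonZeroₒ β
≢𝟎⇒nonZero {𝟎} β≢𝟎 = β≢𝟎 refl
≢𝟎⇒nonZero {ω^ _ + _} _ = tt

++ₒ-nonZero : ∀ ρ {σ} → NonZeroₒ σ → NonZeroₒ (ρ ++ₒ σ)
++ₒ-nonZero 𝟎 σ≢𝟎 = σ≢𝟎
++ₒ-nonZero (ω^ _ + _) _ = tt

infix 4 _∈ₒ_
data _∈ₒ_ (t : Ord) : Ord → Set where
  here  : ∀ {b} → t ∈ₒ ω^ t + b
  there : ∀ {a b} → t ∈ₒ b → t ∈ₒ ω^ a + b

∈-++ₒ⁺ʳ : ∀ ρ {σ t} → t ∈ₒ σ → t ∈ₒ ρ ++ₒ σ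
∈-++ₒ⁺ʳ 𝟎 m = m
∈-++ₒ⁺ʳ (ω^ a + ρ) m = there (∈-++ₒ⁺ʳ ρ m)

ω^·-+ : ∀ a m n → ω^ a · (m + n) ≡ (ω^ a · m) ++ₒ (ω^ a · n)
ω^·-+ a zero n = refl
ω^·-+ a (suc m) n = cong (ω^ a +_) (ω^·-+ a m n)

ω^+-ω^· : ∀ a k μ → ω^ a + ((ω^ a · k) ++ₒ μ) ≡ (ω^ a · k) ++ₒ (ω^ a + μ)
ω^+-ω^· a zero μ = refl
ω^+-ω^· a (suc k) μ = cong (ω^ a +_) (ω^+-ω^· a k μ)

∈-ω^· : ∀ {t a} k → t ∈ₒ ω^ a · k → t ≡ a
∈-ω^· (suc k) here = refl
∈-ω^· (suc k) (there m) = ∈-ω^· k m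

𝟏 : Ord
𝟏 = ω^ 𝟎 + 𝟎

sucₒ : Ord → Ord
sucₒ g = g ++ₒ 𝟏

size : Ord → ℕ
size 𝟎 = 0
size (ω^ a + b) = suc (size a + size b)

lengthₒ : Ord → ℕ
lengthₒ 𝟎 = 0
lengthₒ (ω^ a + b) = suc (lengthₒ b)

size-++ₒ : ∀ ρ σ → size (ρ ++ₒ σ) ≡ size ρ + size σ
size-++ₒ 𝟎 σ = refl
size-++ₒ (ω^ a + ρ) σ =
  cong suc (trans (cong (size a +_) (size-++ₒ ρ σ)) (sym (+-assoc (size a) (size ρ) (size σ))))

size-sucₒ : ∀ g → size (sucₒ g) ≡ size g + 1
size-sucₒ g = size-++ₒ g 𝟏

size-ω^· : ∀ a k → size (ω^ a · k) ≡ k * suc (size a)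
size-ω^· a zero = refl
size-ω^· a (suc k) = cong (suc (size a) +_) (size-ω^· a k)

size-head< : ∀ a b → size a < size (ω^ a + b)
size-head< a b = s≤s (m≤m+n (size a) (size b))

size-tail< : ∀ a b → size b < size (ω^ a + b)
size-tail< a b = s≤s (m≤n+m (size b) (size a))

size-∈ : ∀ {t μ} → t ∈ₒ μ → size t < size μ
size-∈ {t} {ω^ .t + b} here = size-head< t b
size-∈ {μ = ω^ a + b} (there m) = <-trans (size-∈ m) (size-tail< a b)

lengthₒ≤size : ∀ a → lengthₒ a ≤ size a
lengthₒ≤size 𝟎 = z≤n
lengthₒ≤size (ω^ a + b) = s≤s (≤-trans (lengthₒ≤size b) (m≤n+m (size b) (size a)))

lengthₒ-ω^· : ∀ a k → lengthₒ (ω^ a · k) ≡ k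
lengthₒ-ω^· a zero = refl
lengthₒ-ω^· a (suc k) = cong suc (lengthₒ-ω^· a k)

-- Natural sum

-- `_⊕_` is computed by a where-bound `go` that also abstracts the whole second summand, so
-- unfolding (ω^ a + a') ⊕ (ω^ c + c') leaves that function applied to ω^ c + c' and c'
-- instead of (ω^ a + a') ⊕ c'. `merge` names it: the metavariable is solved by unification
-- in ⊕-unfold-<, after which merge-irrelevant removes the spurious argument.
mutual
  merge : Ord → Ord → Ord → Ord → Ord
  merge = _

  ⊕-unfold-< : ∀ a a' c c' → compare a c ≡ lt →
               (ω^ a + a') ⊕ (ω^ c + c') ≡ ω^ c + merge a a' (ω^ c + c') c'
  ⊕-unfold-< a a' c c' e with compare a c | ω^ c + c'
  ... | lt | B = refl

merge-irrelevant : ∀ a a' B B' f → merge a a' B f ≡ merge a a' B' f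
merge-irrelevant a a' B B' 𝟎 = refl
merge-irrelevant a a' B B' (ω^ c + f) with compare a c
... | lt = cong (ω^ c +_) (merge-irrelevant a a' B B' f)
... | eq = refl
... | gt = refl

⊕-< : ∀ {a a' c c'} → a <ₒ c → (ω^ a + a') ⊕ (ω^ c + c') ≡ ω^ c + ((ω^ a + a') ⊕ c')
⊕-< {a} {a'} {c} {c'} (mk<ₒ a<c) =
  trans (⊕-unfold-< a a' c c' a<c) (cong (ω^ c +_) (merge-irrelevant a a' (ω^ c + c') c' c'))

⊕-≽ : ∀ {a a' c c'} → c ≼ a → (ω^ a + a') ⊕ (ω^ c + c') ≡ ω^ a + (a' ⊕ (ω^ c + c'))
⊕-≽ {a} {c = c} c≼a with compare a c in e
... | lt = ⊥-elim (<ₒ-irrefl (≼-<ₒ-trans c≼a (mk<ₒ e)))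
... | eq = refl
... | gt = refl

⊕-identityʳ : ∀ X → X ⊕ 𝟎 ≡ X
⊕-identityʳ 𝟎 = refl
⊕-identityʳ (ω^ a + a') = refl

⊕-nonZero : ∀ X Y → NonZeroₒ X → NonZeroₒ (X ⊕ Y)
⊕-nonZero (ω^ a + a') 𝟎 _ = tt
⊕-nonZero (ω^ a + a') (ω^ c + c') _ with <ₒ-or-≽ a c
... | inj₁ a<c rewrite ⊕-< {a' = a'} {c' = c'} a<c = tt
... | inj₂ c≼a rewrite ⊕-≽ {a' = a'} {c' = c'} c≼a = tt

∈-⊕⁻ : ∀ X Y {t} → t ∈ₒ X ⊕ Y → t ∈ₒ X ⊎ t ∈ₒ Y
∈-⊕⁻ 𝟎 Y m = inj₂ m
∈-⊕⁻ (ω^ a + a') Y {t} = inner Y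
  where
  inner : ∀ Y → t ∈ₒ (ω^ a + a') ⊕ Y → t ∈ₒ ω^ a + a' ⊎ t ∈ₒ Y
  inner 𝟎 m = inj₁ m
  inner (ω^ c + c') m with <ₒ-or-≽ a c
  ... | inj₁ a<c with subst (t ∈ₒ_) (⊕-< a<c) m
  ...   | here = inj₂ here
  ...   | there m' with inner c' m'
  ...     | inj₁ p = inj₁ p
  ...     | inj₂ p = inj₂ (there p)
  inner (ω^ c + c') m | inj₂ c≼a with subst (t ∈ₒ_) (⊕-≽ c≼a) m
  ...   | here = inj₁ here
  ...   | there m' with ∈-⊕⁻ a' (ω^ c + c') m'
  ...     | inj₁ p = inj₁ (there p)
  ...     | inj₂ p = inj₂ p

lengthₒ-⊕ : ∀ X Y → lengthₒ (X ⊕ Y) ≡ lengthₒ X + lengthₒ Y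
lengthₒ-⊕ 𝟎 Y = refl
lengthₒ-⊕ (ω^ a + a') = inner
  where
  inner : ∀ Y → lengthₒ ((ω^ a + a') ⊕ Y) ≡ suc (lengthₒ a' + lengthₒ Y)
  inner 𝟎 = cong suc (sym (+-identityʳ (lengthₒ a')))
  inner (ω^ c + c') with <ₒ-or-≽ a c
  ... | inj₁ a<c = trans (cong lengthₒ (⊕-< a<c))
                         (cong suc (trans (inner c') (sym (+-suc (lengthₒ a') (lengthₒ c')))))
  ... | inj₂ c≼a = trans (cong lengthₒ (⊕-≽ c≼a)) (cong suc (lengthₒ-⊕ a' (ω^ c + c')))

infix 4 _≻ᵗ_ _≽ᵗ_

_≻ᵗ_ : Ord → Ord → Set
ρ ≻ᵗ σ = ∀ {t s} → t ∈ₒ ρ → s ∈ₒ σ → s <ₒ t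

_≽ᵗ_ : Ord → Ord → Set
ρ ≽ᵗ σ = ∀ {t s} → t ∈ₒ ρ → s ∈ₒ σ → s ≼ t

⊕-++ₒʳ : ∀ X' Y Y' → Y ≻ᵗ X' → X' ⊕ (Y ++ₒ Y') ≡ Y ++ₒ (X' ⊕ Y')
⊕-++ₒʳ X' 𝟎 Y' Y≻X' = refl
⊕-++ₒʳ 𝟎 (ω^ c + Y) Y' Y≻X' = refl
⊕-++ₒʳ (ω^ a + X) (ω^ c + Y) Y' Y≻X' =
  trans (⊕-< (Y≻X' here here))
        (cong (ω^ c +_) (⊕-++ₒʳ (ω^ a + X) Y Y' (λ mt ms → Y≻X' (there mt) ms)))

⊕-++ₒˡ : ∀ X X' Y' → X ≽ᵗ Y' → (X ++ₒ X') ⊕ Y' ≡ X ++ₒ (X' ⊕ Y')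
⊕-++ₒˡ 𝟎 X' Y' X≽Y' = refl
⊕-++ₒˡ (ω^ a + X) X' 𝟎 X≽Y' = cong (λ ξ → ω^ a + (X ++ₒ ξ)) (sym (⊕-identityʳ X'))
⊕-++ₒˡ (ω^ a + X) X' (ω^ c + Y) X≽Y' =
  trans (⊕-≽ (X≽Y' here here))
        (cong (ω^ a +_) (⊕-++ₒˡ X X' (ω^ c + Y) (λ mt ms → X≽Y' (there mt) ms)))

⊕-++ₒ : ∀ X X' Y Y' → X ≽ᵗ Y' → Y ≻ᵗ X' → (X ++ₒ X') ⊕ (Y ++ₒ Y') ≡ (X ⊕ Y) ++ₒ (X' ⊕ Y')
⊕-++ₒ 𝟎 X' Y Y' X≽Y' Y≻X' = ⊕-++ₒʳ X' Y Y' Y≻X'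
⊕-++ₒ (ω^ a + X) X' Y Y' X≽Y' = inner Y
  where
  inner : ∀ Y → Y ≻ᵗ X' → (ω^ a + (X ++ₒ X')) ⊕ (Y ++ₒ Y') ≡ ((ω^ a + X) ⊕ Y) ++ₒ (X' ⊕ Y')
  inner 𝟎 _ = ⊕-++ₒˡ (ω^ a + X) X' Y' X≽Y'
  inner (ω^ c + Y) Y≻X' with <ₒ-or-≽ a c
  ... | inj₁ a<c =
    trans (⊕-< a<c)
          (trans (cong (ω^ c +_) (inner Y (λ mt ms → Y≻X' (there mt) ms)))
                 (cong (_++ₒ (X' ⊕ Y')) (sym (⊕-< a<c))))
  ... | inj₂ c≼a =
    trans (⊕-≽ c≼a)
          (trans (cong (ω^ a +_) (⊕-++ₒ X X' (ω^ c + Y) Y' (λ mt ms → X≽Y' (there mt) ms) Y≻X'))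
                 (cong (_++ₒ (X' ⊕ Y')) (sym (⊕-≽ c≼a))))

<ₒ-sucₒ : ∀ g → g <ₒ sucₒ g
<ₒ-sucₒ 𝟎 = 𝟎<ω^
<ₒ-sucₒ (ω^ a + b) = <ₒ-tail a (<ₒ-sucₒ b)

<ₒ⇒sucₒ≼ : ∀ g d → g <ₒ d → sucₒ g ≼ d
<ₒ⇒sucₒ≼ g 𝟎 g<d = ⊥-elim (≮𝟎 g<d)
<ₒ⇒sucₒ≼ 𝟎 (ω^ 𝟎 + 𝟎) _ = inj₂ refl
<ₒ⇒sucₒ≼ 𝟎 (ω^ 𝟎 + (ω^ _ + _)) _ = inj₁ (<ₒ-tail 𝟎 𝟎<ω^)
<ₒ⇒sucₒ≼ 𝟎 (ω^ (ω^ _ + _) + _) _ = inj₁ (<ₒ-head 𝟎 _ 𝟎<ω^)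
<ₒ⇒sucₒ≼ (ω^ g₁ + g₂) (ω^ d₁ + d₂) g<d with <ₒ-ω^⁻ g<d
... | inj₁ p = inj₁ (<ₒ-head (sucₒ g₂) d₂ p)
... | inj₂ (refl , p) = ≼-tail g₁ (<ₒ⇒sucₒ≼ g₂ d₂ p)

<ₒ-sucₒ⇒≼ : ∀ t c → t <ₒ sucₒ c → t ≼ c
<ₒ-sucₒ⇒≼ 𝟎 c _ = 𝟎≼ c
<ₒ-sucₒ⇒≼ (ω^ t₁ + t₂) 𝟎 t<c+1 with <ₒ-ω^⁻ t<c+1
... | inj₁ p = ⊥-elim (≮𝟎 p)
... | inj₂ (_ , p) = ⊥-elim (≮𝟎 p)
<ₒ-sucₒ⇒≼ (ω^ t₁ + t₂) (ω^ c₁ + c₂) t<c+1 with <ₒ-ω^⁻ t<c+1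
... | inj₁ p = inj₁ (<ₒ-head t₂ c₂ p)
... | inj₂ (refl , p) = ≼-tail t₁ (<ₒ-sucₒ⇒≼ t₂ c₂ p)

wf-head : ∀ {a b} → WF (ω^ a + b) → WF a
wf-head (wfω w _ _) = w

wf-tail : ∀ {a b} → WF (ω^ a + b) → WF b
wf-tail (wfω _ w _) = w

wf-lead : ∀ {a b} → WF (ω^ a + b) → LeadLE b a
wf-lead (wfω _ _ l) = l

LeadLE-≼ : ∀ b {a a'} → LeadLE b a → a ≼ a' → LeadLE b a'
LeadLE-≼ 𝟎 _ _ = tt
LeadLE-≼ (ω^ c + d) {a} l a≼a' = ≼⇒≤ₒ (≼-trans (≤ₒ⇒≼ {c} {a} l) a≼a')

∈-≼-lead : ∀ {τ g t} → WF τ → LeadLE τ g → t ∈ₒ τ → t ≼ g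
∈-≼-lead _ l here = ≤ₒ⇒≼ l
∈-≼-lead {ω^ c + d} w l (there m) = ∈-≼-lead (wf-tail w) (LeadLE-≼ d (wf-lead w) (≤ₒ⇒≼ l)) m

∈-≼-head : ∀ {t r u} → WF (ω^ t + r) → u ∈ₒ ω^ t + r → u ≼ t
∈-≼-head {t} w = ∈-≼-lead w (≼⇒≤ₒ {t} ≼-refl)

wf-∈ : ∀ {t τ} → WF τ → t ∈ₒ τ → WF t
wf-∈ w here = wf-head w
wf-∈ w (there m) = wf-∈ (wf-tail w) m

wf-sucₒ : ∀ g → WF g → WF (sucₒ g)
wf-sucₒ 𝟎 _ = wfω wf𝟎 wf𝟎 tt
wf-sucₒ (ω^ a + 𝟎) (wfω wa _ _) = wfω wa (wf-sucₒ 𝟎 wf𝟎) (≼⇒≤ₒ (𝟎≼ a))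
wf-sucₒ (ω^ a + b@(ω^ _ + _)) (wfω wa wb l) = wfω wa (wf-sucₒ b wb) l

wf-++ₒ⁻ˡ : ∀ ρ σ → WF (ρ ++ₒ σ) → WF ρ
wf-++ₒ⁻ˡ 𝟎 σ _ = wf𝟎
wf-++ₒ⁻ˡ (ω^ a + 𝟎) σ w = wfω (wf-head w) wf𝟎 tt
wf-++ₒ⁻ˡ (ω^ a + ρ@(ω^ _ + _)) σ w = wfω (wf-head w) (wf-++ₒ⁻ˡ ρ σ (wf-tail w)) (wf-lead w)

wf-++ₒ⁻ʳ : ∀ ρ σ → WF (ρ ++ₒ σ) → WF σ
wf-++ₒ⁻ʳ 𝟎 σ w = w
wf-++ₒ⁻ʳ (ω^ a + ρ) σ w = wf-++ₒ⁻ʳ ρ σ (wf-tail w)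

LeadLE-ω^· : ∀ a k → LeadLE (ω^ a · k) a
LeadLE-ω^· a zero = tt
LeadLE-ω^· a (suc k) = ≼⇒≤ₒ {a} ≼-refl

wf-ω^· : ∀ a k → WF a → WF (ω^ a · k)
wf-ω^· a zero w = wf𝟎
wf-ω^· a (suc k) w = wfω w (wf-ω^· a k w) (LeadLE-ω^· a k)

LeadLE-⊕ : ∀ X Y {m} → LeadLE X m → LeadLE Y m → LeadLE (X ⊕ Y) m
LeadLE-⊕ 𝟎 Y lx ly = ly
LeadLE-⊕ (ω^ a + a') 𝟎 lx ly = lx
LeadLE-⊕ (ω^ a + a') (ω^ c + c') lx ly with <ₒ-or-≽ a c
... | inj₁ a<c rewrite ⊕-< {a' = a'} {c' = c'} a<c = ly
... | inj₂ c≼a rewrite ⊕-≽ {a' = a'} {c' = c'} c≼a = lx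

wf-⊕ : ∀ X Y → WF X → WF Y → WF (X ⊕ Y)
wf-⊕ 𝟎 Y wx wy = wy
wf-⊕ (ω^ a + a') Y wx = inner Y
  where
  inner : ∀ Y → WF Y → WF ((ω^ a + a') ⊕ Y)
  inner 𝟎 _ = wx
  inner (ω^ c + c') wy with <ₒ-or-≽ a c
  ... | inj₁ a<c = subst WF (sym (⊕-< a<c))
      (wfω (wf-head wy) (inner c' (wf-tail wy))
           (LeadLE-⊕ (ω^ a + a') c' (≼⇒≤ₒ (inj₁ a<c)) (wf-lead wy)))
  ... | inj₂ c≼a = subst WF (sym (⊕-≽ c≼a))
      (wfω (wf-head wx) (wf-⊕ a' (ω^ c + c') (wf-tail wx) wy)
           (LeadLE-⊕ a' (ω^ c + c') (wf-lead wx) (≼⇒≤ₒ c≼a)))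

-- Fundamental sequences

fs-ω^+ : ∀ a {b} x → NonZeroₒ b → fs (ω^ a + b) x ≡ ω^ a + fs b x
fs-ω^+ a {ω^ _ + _} x _ = refl

prependKind : Ord → Kind → Kind
prependKind a zeroK = zeroK
prependKind a (succK b) = succK (ω^ a + b)
prependKind a limK = limK

kind-ω^+ : ∀ a b → NonZeroₒ b → kind (ω^ a + b) ≡ prependKind a (kind b)
kind-ω^+ 𝟎 b@(ω^ _ + _) _ with kind b
... | zeroK = refl
... | succK _ = refl
... | limK = refl
kind-ω^+ (ω^ _ + _) b@(ω^ _ + _) _ with kind b
... | zeroK = refl
... | succK _ = refl
... | limK = refl

prependKind≡zeroK⁻ : ∀ {a} k → prependKind a k ≡ zeroK → k ≡ zeroK
prependKind≡zeroK⁻ zeroK _ = refl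

prependKind≡limK⁻ : ∀ {a} k → prependKind a k ≡ limK → k ≡ limK
prependKind≡limK⁻ limK _ = refl

kind≡zeroK⇒≡𝟎 : ∀ a → kind a ≡ zeroK → a ≡ 𝟎
kind≡zeroK⇒≡𝟎 𝟎 _ = refl
kind≡zeroK⇒≡𝟎 (ω^ 𝟎 + 𝟎) ()
kind≡zeroK⇒≡𝟎 (ω^ (ω^ _ + _) + 𝟎) ()
kind≡zeroK⇒≡𝟎 (ω^ a + b@(ω^ _ + _)) e
  with kind≡zeroK⇒≡𝟎 b (prependKind≡zeroK⁻ (kind b) (trans (sym (kind-ω^+ a b tt)) e))
... | ()

kind≡limK⇒nonZero : ∀ a → kind a ≡ limK → NonZeroₒ a
kind≡limK⇒nonZero (ω^ _ + _) _ = tt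

kind-ω^+-limK : ∀ a b → NonZeroₒ b → kind (ω^ a + b) ≡ limK → kind b ≡ limK
kind-ω^+-limK a b b≢𝟎 e = prependKind≡limK⁻ (kind b) (trans (sym (kind-ω^+ a b b≢𝟎)) e)

kind-sucₒ : ∀ g → kind (sucₒ g) ≡ succK g
kind-sucₒ 𝟎 = refl
kind-sucₒ (ω^ a + b) rewrite kind-ω^+ a (sucₒ b) (++ₒ-nonZero b tt) | kind-sucₒ b = refl

kind≡succK⇒≡sucₒ : ∀ a {g} → kind a ≡ succK g → a ≡ sucₒ g
kind≡succK⇒≡sucₒ (ω^ 𝟎 + 𝟎) refl = refl
kind≡succK⇒≡sucₒ (ω^ a + b@(ω^ _ + _)) e rewrite kind-ω^+ a b tt with kind b in kb
kind≡succK⇒≡sucₒ (ω^ a + b@(ω^ _ + _)) refl | succK g = cong (ω^ a +_) (kind≡succK⇒≡sucₒ b kb)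

fsω^ : Kind → Ord → ℕ → Ord
fsω^ zeroK a x = 𝟎
fsω^ (succK a') a x = ω^ a' · x
fsω^ limK a x = ω^ (fs a x) + 𝟎

fs-ω^ : ∀ a x → fs (ω^ a + 𝟎) x ≡ fsω^ (kind a) a x
fs-ω^ a x with kind a
... | zeroK = refl
... | succK _ = refl
... | limK = refl

fs-sucₒ : ∀ g x → fs (sucₒ g) x ≡ g
fs-sucₒ 𝟎 x = refl
fs-sucₒ (ω^ a + b) x = trans (fs-ω^+ a x (++ₒ-nonZero b tt)) (cong (ω^ a +_) (fs-sucₒ b x))

fs-++ₒ : ∀ ρ σ x → NonZeroₒ σ → fs (ρ ++ₒ σ) x ≡ ρ ++ₒ fs σ x
fs-++ₒ 𝟎 σ x σ≢𝟎 = refl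
fs-++ₒ (ω^ a + ρ) σ x σ≢𝟎 =
  trans (fs-ω^+ a x (++ₒ-nonZero ρ σ≢𝟎)) (cong (ω^ a +_) (fs-++ₒ ρ σ x σ≢𝟎))

fs-<ₒ : ∀ δ x → NonZeroₒ δ → fs δ x <ₒ δ
fs-<ₒ (ω^ a + b@(ω^ _ + _)) x _ = <ₒ-tail a (fs-<ₒ b x tt)
fs-<ₒ (ω^ a + 𝟎) x _ rewrite fs-ω^ a x with kind a in ka
... | zeroK = 𝟎<ω^
... | succK a' = ω^·-< x
  where
  ω^·-< : ∀ x → ω^ a' · x <ₒ ω^ a + 𝟎
  ω^·-< zero = 𝟎<ω^
  ω^·-< (suc x) = <ₒ-head _ 𝟎 (subst (a' <ₒ_) (sym (kind≡succK⇒≡sucₒ a ka)) (<ₒ-sucₒ a'))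
... | limK = <ₒ-head 𝟎 𝟎 (fs-<ₒ a x (kind≡limK⇒nonZero a ka))

LeadLE-fs : ∀ b {a} x → LeadLE b a → LeadLE (fs b x) a
LeadLE-fs 𝟎 x l = tt
LeadLE-fs (ω^ c + (ω^ _ + _)) x l = l
LeadLE-fs (ω^ c + 𝟎) {a} x l rewrite fs-ω^ c x with kind c in kc
... | zeroK = tt
... | succK c' = lead x
  where
  lead : ∀ x → LeadLE (ω^ c' · x) a
  lead zero = tt
  lead (suc x) = ≼⇒≤ₒ (≼-trans (inj₁ (subst (c' <ₒ_) (sym (kind≡succK⇒≡sucₒ c kc)) (<ₒ-sucₒ c')))
                               (≤ₒ⇒≼ {c} {a} l))
... | limK = ≼⇒≤ₒ (≼-trans (inj₁ (fs-<ₒ c x (kind≡limK⇒nonZero c kc))) (≤ₒ⇒≼ {c} {a} l))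

wf-fs : ∀ δ x → WF δ → WF (fs δ x)
wf-fs 𝟎 x w = wf𝟎
wf-fs (ω^ a + b@(ω^ _ + _)) x (wfω wa wb l) = wfω wa (wf-fs b x wb) (LeadLE-fs b x l)
wf-fs (ω^ a + 𝟎) x (wfω wa _ _) rewrite fs-ω^ a x with kind a in ka
... | zeroK = wf𝟎
... | succK a' = wf-ω^· a' x (wf-++ₒ⁻ˡ a' 𝟏 (subst WF (kind≡succK⇒≡sucₒ a ka) wa))
... | limK = wfω (wf-fs a x wa) wf𝟎 tt

fs-succK : ∀ a {g} x → kind a ≡ succK g → fs a x ≡ g
fs-succK a {g} x e = trans (cong (λ δ → fs δ x) (kind≡succK⇒≡sucₒ a e)) (fs-sucₒ g x)

size-fs : ∀ γ {u} → NonZeroₒ γ → 1 ≤ u → size γ ≤ suc (size (fs γ u))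
size-fs (ω^ a + b@(ω^ _ + _)) {u} _ 1≤u =
  s≤s (subst (size a + size b ≤_) (+-suc (size a) _) (+-monoʳ-≤ (size a) (size-fs b tt 1≤u)))
size-fs (ω^ a + 𝟎) {u} _ 1≤u rewrite fs-ω^ a u | +-identityʳ (size a) with kind a in ka
... | zeroK rewrite kind≡zeroK⇒≡𝟎 a ka = s≤s z≤n
... | succK g rewrite kind≡succK⇒≡sucₒ a ka | size-ω^· g u | size-sucₒ g = s≤s (copies u 1≤u)
  where
  copies : ∀ u → 1 ≤ u → size g + 1 ≤ u * suc (size g)
  copies (suc u) _ = subst (_≤ suc (size g) + u * suc (size g)) (+-comm 1 (size g)) (m≤m+n _ _)
... | limK =
  s≤s (subst (size a ≤_) (cong suc (sym (+-identityʳ _))) (size-fs a (kind≡limK⇒nonZero a ka) 1≤u))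

-- Descent along fundamental sequences

infix 4 _⟶[_]_ _↠[_]_

data _⟶[_]_ : Ord → ℕ → Ord → Set where
  fs-step : ∀ {a b q} → ω^ a + b ⟶[ q ] fs (ω^ a + b) q

_↠[_]_ : Ord → ℕ → Ord → Set
δ ↠[ q ] γ = Star (_⟶[ q ]_) δ γ

⟶-++ₒ : ∀ ρ {q δ γ} → δ ⟶[ q ] γ → ρ ++ₒ δ ↠[ q ] ρ ++ₒ γ
⟶-++ₒ 𝟎 fs-step = fs-step ◅ ε
⟶-++ₒ (ω^ a + ρ) {q} (fs-step {a'} {b'}) =
  subst (ω^ a + (ρ ++ₒ (ω^ a' + b')) ↠[ q ]_) fs-shift (fs-step ◅ ε)
  where
  fs-shift : fs (ω^ a + (ρ ++ₒ (ω^ a' + b'))) q ≡ ω^ a + (ρ ++ₒ fs (ω^ a' + b') q)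
  fs-shift = trans (fs-ω^+ a q (++ₒ-nonZero ρ tt)) (cong (ω^ a +_) (fs-++ₒ ρ (ω^ a' + b') q tt))

↠-++ₒ : ∀ ρ {q δ γ} → δ ↠[ q ] γ → ρ ++ₒ δ ↠[ q ] ρ ++ₒ γ
↠-++ₒ ρ ε = ε
↠-++ₒ ρ (s ◅ d) = ⟶-++ₒ ρ s ◅◅ ↠-++ₒ ρ d

↠-ω^+ : ∀ a {q δ γ} → δ ↠[ q ] γ → ω^ a + δ ↠[ q ] ω^ a + γ
↠-ω^+ a = ↠-++ₒ (ω^ a + 𝟎)

ω^·-↠𝟎 : ∀ {q} a → ω^ a + 𝟎 ↠[ q ] 𝟎 → ∀ k → ω^ a · k ↠[ q ] 𝟎
ω^·-↠𝟎 a d zero = ε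
ω^·-↠𝟎 a d (suc k) = ↠-ω^+ a (ω^·-↠𝟎 a d k) ◅◅ d

ω^-↠𝟎 : ∀ {q} a → a ↠[ q ] 𝟎 → ω^ a + 𝟎 ↠[ q ] 𝟎
ω^-↠𝟎 𝟎 ε = fs-step ◅ ε
ω^-↠𝟎 {q} a@(ω^ _ + _) (fs-step ◅ d) =
  fs-step ◅ subst (_↠[ q ] 𝟎) (sym (fs-ω^ a q)) (byKind (kind a) refl)
  where
  byKind : ∀ k → kind a ≡ k → fsω^ k a q ↠[ q ] 𝟎
  byKind zeroK e with kind≡zeroK⇒≡𝟎 a e
  ... | ()
  byKind (succK g) e =
    ω^·-↠𝟎 g (subst (λ δ → ω^ δ + 𝟎 ↠[ q ] 𝟎) (fs-succK a q e) (ω^-↠𝟎 (fs a q) d)) q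
  byKind limK e = ω^-↠𝟎 (fs a q) d

↠𝟎 : ∀ {q} δ → δ ↠[ q ] 𝟎
↠𝟎 𝟎 = ε
↠𝟎 (ω^ a + b) = ↠-ω^+ a (↠𝟎 b) ◅◅ ω^-↠𝟎 a (↠𝟎 a)

ω^·-↠ : ∀ {r} a {p q} → p ≤ q → ω^ a · q ↠[ r ] ω^ a · p
ω^·-↠ a {q = q} z≤n = ↠𝟎 (ω^ a · q)
ω^·-↠ a (s≤s p≤q) = ↠-ω^+ a (ω^·-↠ a p≤q)

ω^-fs-↠ : ∀ {q} d → NonZeroₒ d → 1 ≤ q → ω^ d + 𝟎 ↠[ q ] ω^ fs d q + 𝟎
ω^-fs-↠ {suc q} d d≢𝟎 _ =
  fs-step ◅ subst (_↠[ suc q ] ω^ fs d (suc q) + 𝟎) (sym (fs-ω^ d (suc q))) (byKind (kind d) refl)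
  where
  byKind : ∀ k → kind d ≡ k → fsω^ k d (suc q) ↠[ suc q ] ω^ fs d (suc q) + 𝟎
  byKind zeroK e with kind≡zeroK⇒≡𝟎 d e
  byKind zeroK e | refl = ⊥-elim d≢𝟎
  byKind (succK g) e rewrite fs-succK d (suc q) e = ↠-ω^+ g (↠𝟎 (ω^ g · q))
  byKind limK e = ε

↠-ω^ : ∀ {q} → 1 ≤ q → ∀ {d g} → d ↠[ q ] g → ω^ d + 𝟎 ↠[ q ] ω^ g + 𝟎
↠-ω^ _ ε = ε
↠-ω^ 1≤q (fs-step ◅ d) = ω^-fs-↠ _ tt 1≤q ◅◅ ↠-ω^ 1≤q d

ω^-↠𝟏 : ∀ {q} → 1 ≤ q → ∀ a → ω^ a + 𝟎 ↠[ q ] 𝟏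
ω^-↠𝟏 1≤q a = ↠-ω^ 1≤q (↠𝟎 a)

ω^-sucₒ-↠ : ∀ {q} g → ω^ sucₒ g + 𝟎 ↠[ q ] ω^ g · q
ω^-sucₒ-↠ {q} g = fs-step ◅ subst (_↠[ q ] ω^ g · q) (sym fs-ω^-sucₒ) ε
  where
  fs-ω^-sucₒ : fs (ω^ sucₒ g + 𝟎) q ≡ ω^ g · q
  fs-ω^-sucₒ = trans (fs-ω^ (sucₒ g) q) (cong (λ k → fsω^ k (sucₒ g) q) (kind-sucₒ g))

fs-↠-fs : ∀ {r} → 1 ≤ r → ∀ δ {p q} → p ≤ q → fs δ q ↠[ r ] fs δ p
fs-↠-fs 1≤r 𝟎 p≤q = ε
fs-↠-fs 1≤r (ω^ a + b@(ω^ _ + _)) p≤q = ↠-ω^+ a (fs-↠-fs 1≤r b p≤q)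
fs-↠-fs 1≤r (ω^ a + 𝟎) {p} {q} p≤q rewrite fs-ω^ a q | fs-ω^ a p with kind a
... | zeroK = ε
... | succK g = ω^·-↠ g p≤q
... | limK = ↠-ω^ 1≤r (fs-↠-fs 1≤r a p≤q)

ω^·-↠-ω^+𝟏 : ∀ {r} → 1 ≤ r → ∀ a {q} → 2 ≤ q → ω^ a · q ↠[ r ] ω^ a + 𝟏
ω^·-↠-ω^+𝟏 1≤r a {suc (suc q)} _ = ↠-ω^+ a (↠-ω^+ a (↠𝟎 (ω^ a · q)) ◅◅ ω^-↠𝟏 1≤r a)
ω^·-↠-ω^+𝟏 1≤r a {suc zero} (s≤s ())

fs-↠-sucₒ-fs : ∀ {q} → 2 ≤ q → ∀ b {x y} → kind b ≡ limK → x < y → fs b y ↠[ q ] sucₒ (fs b x)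
fs-↠-sucₒ-fs 2≤q (ω^ a + b@(ω^ _ + _)) lim x<y =
  ↠-ω^+ a (fs-↠-sucₒ-fs 2≤q b (kind-ω^+-limK a b tt lim) x<y)
fs-↠-sucₒ-fs {q} 2≤q (ω^ a + 𝟎) {x} {y} lim x<y =
  subst₂ _↠[ q ]_ (sym (fs-ω^ a y)) (cong sucₒ (sym (fs-ω^ a x))) (byKind (kind a) refl)
  where
  1≤q : 1 ≤ q
  1≤q = ≤-trans (s≤s z≤n) 2≤q
  byKind : ∀ k → kind a ≡ k → fsω^ k a y ↠[ q ] sucₒ (fsω^ k a x)
  byKind zeroK e with subst (λ c → kind (ω^ c + 𝟎) ≡ limK) (kind≡zeroK⇒≡𝟎 a e) lim
  ... | ()
  byKind (succK g) e =
    ω^·-↠ g x<y ◅◅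
    subst (_↠[ q ] sucₒ (ω^ g · x)) (sym (trans (cong (ω^ g ·_) (+-comm 1 x)) (ω^·-+ g x 1)))
          (↠-++ₒ (ω^ g · x) (ω^-↠𝟏 1≤q g))
  byKind limK e =
    ↠-ω^ 1≤q (fs-↠-sucₒ-fs 2≤q a e x<y) ◅◅ ω^-sucₒ-↠ (fs a x) ◅◅ ω^·-↠-ω^+𝟏 1≤q (fs a x) 2≤q

<ₒ-ω^· : ∀ γ g k → WF γ → LeadLE γ g → size γ < k → γ <ₒ ω^ g · k
<ₒ-ω^· 𝟎 g (suc k) _ _ _ = 𝟎<ω^
<ₒ-ω^· (ω^ t + r) g (suc k) w l small with ≤ₒ⇒≼ {t} {g} l
... | inj₁ t<g = <ₒ-head r (ω^ g · k) t<g
... | inj₂ refl =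
  <ₒ-tail t (<ₒ-ω^· r t k (wf-tail w) (wf-lead w) (<-≤-trans (size-tail< t r) (≤-pred small)))

-- The fuel bounds size γ: the recursion through sucₒ g is not structural.
private
  mutual
    ↠-<ₒ′ : ∀ n {q} δ γ → size γ < n → WF γ → γ <ₒ δ → size γ < q → δ ↠[ q ] γ
    ↠-<ₒ′ (suc n) δ 𝟎 _ _ _ _ = ↠𝟎 δ
    ↠-<ₒ′ (suc n) 𝟎 (ω^ _ + _) _ _ γ<δ _ = ⊥-elim (≮𝟎 γ<δ)
    ↠-<ₒ′ (suc n) (ω^ d + δ) (ω^ g + γ) fuel w γ<δ small with <ₒ-ω^⁻ γ<δ
    ... | inj₂ (refl , γ<δ′) =
      ↠-ω^+ g (↠-<ₒ′ n δ γ (<-≤-trans (size-tail< g γ) (≤-pred fuel)) (wf-tail w) γ<δ′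
                           (<-trans (size-tail< g γ) small))
    ... | inj₁ g<d = ↠-ω^+ d (↠𝟎 δ) ◅◅ ω^-↠-<ₒ′ n d g γ (≤-pred fuel) w g<d small

    ω^-↠-<ₒ′ : ∀ n {q} d g γ → size (ω^ g + γ) ≤ n → WF (ω^ g + γ) → g <ₒ d → size (ω^ g + γ) < q →
               ω^ d + 𝟎 ↠[ q ] ω^ g + γ
    ω^-↠-<ₒ′ n d g 𝟎 fuel w g<d small =
      ↠-ω^ (≤-trans (s≤s z≤n) small)
           (↠-<ₒ′ n d g (<-≤-trans (size-head< g 𝟎) fuel) (wf-head w) g<d
                       (<-trans (size-head< g 𝟎) small))
    ω^-↠-<ₒ′ n {q} d g γ@(ω^ c + e) fuel w g<d small =
      ↠-ω^ (≤-trans (s≤s z≤n) small) d↠g+1 ◅◅ ω^-sucₒ-↠ g ◅◅ ω^·-↠-ω^+ q small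
      where
      size-g+1< : size (sucₒ g) < size (ω^ g + γ)
      size-g+1< rewrite size-sucₒ g = s≤s (+-monoʳ-≤ (size g) (s≤s z≤n))
      d↠g+1 : d ↠[ q ] sucₒ g
      d↠g+1 with <ₒ⇒sucₒ≼ g d g<d
      ... | inj₂ refl = ε
      ... | inj₁ g+1<d =
        ↠-<ₒ′ n d (sucₒ g) (<-≤-trans size-g+1< fuel) (wf-sucₒ g (wf-head w)) g+1<d
              (<-trans size-g+1< small)
      ω^·-↠-ω^+ : ∀ k → size (ω^ g + γ) < k → ω^ g · k ↠[ q ] ω^ g + γ
      ω^·-↠-ω^+ (suc k) small-k =
        ↠-ω^+ g (↠-<ₒ′ n (ω^ g · k) γ (<-≤-trans (size-tail< g γ) fuel) (wf-tail w)
                      (<ₒ-ω^· γ g k (wf-tail w) (wf-lead w)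
                              (<-≤-trans (size-tail< g γ) (≤-pred small-k)))
                      (<-trans (size-tail< g γ) small))

↠-<ₒ : ∀ {q} δ γ → WF γ → γ <ₒ δ → size γ < q → δ ↠[ q ] γ
↠-<ₒ δ γ = ↠-<ₒ′ (suc (size γ)) δ γ ≤-refl

↠-sucₒ : ∀ {q} s t → WF t → t <ₒ s → size t + 1 < q → s ↠[ q ] sucₒ t
↠-sucₒ {q} s t w t<s small with <ₒ⇒sucₒ≼ t s t<s
... | inj₂ refl = ε
... | inj₁ t+1<s = ↠-<ₒ s (sucₒ t) (wf-sucₒ t w) t+1<s (subst (_< q) (sym (size-sucₒ t)) small)

-- Descent to a natural sum with a tail of small terms

Linked : ℕ → Ord → Set
Linked q τ = ∀ {t t'} → t ∈ₒ τ → t' ∈ₒ τ → t' <ₒ t → t ↠[ q ] sucₒ t'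

linked-tail : ∀ {q a τ} → Linked q (ω^ a + τ) → Linked q τ
linked-tail linked mt mt' = linked (there mt) (there mt')

ω^·-↠-linked : ∀ {q} g k τ → 1 ≤ q → k ≤ q → WF τ → LeadLE τ g →
               (∀ {t} → t ∈ₒ τ → t <ₒ g → g ↠[ q ] sucₒ t) → Linked q τ → lengthₒ τ ≤ k →
               ω^ g · k ↠[ q ] τ
ω^·-↠-linked g k 𝟎 _ _ _ _ _ _ _ = ↠𝟎 (ω^ g · k)
ω^·-↠-linked {q} g (suc k) (ω^ t + τ) 1≤q k<q w l below linked len≤k with ≤ₒ⇒≼ {t} {g} l
... | inj₂ refl =
  ↠-ω^+ t (ω^·-↠-linked t k τ 1≤q (≤-trans (n≤1+n k) k<q) (wf-tail w) (wf-lead w)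
                       (λ m → below (there m)) (linked-tail linked) (≤-pred len≤k))
... | inj₁ t<g =
  ↠-ω^+ g (↠𝟎 (ω^ g · k)) ◅◅ ↠-ω^ 1≤q (below here t<g) ◅◅ ω^-sucₒ-↠ t ◅◅ ω^·-↠-ω^+ q ≤-refl k<q
  where
  ω^·-↠-ω^+ : ∀ k′ → k′ ≤ q → suc k ≤ k′ → ω^ t · k′ ↠[ q ] ω^ t + τ
  ω^·-↠-ω^+ (suc k′) k′<q k<k′ =
    ↠-ω^+ t (ω^·-↠-linked t k′ τ 1≤q (≤-trans (n≤1+n k′) k′<q) (wf-tail w) (wf-lead w)
                         (λ m → linked here (there m)) (linked-tail linked)
                         (≤-trans (≤-pred len≤k) (≤-pred k<k′)))

ω^-↠-linked : ∀ {q} s τ → 1 ≤ q → WF τ → (∀ {t} → t ∈ₒ τ → s ↠[ q ] sucₒ t) → Linked q τ →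
              lengthₒ τ ≤ q → ω^ s + 𝟎 ↠[ q ] τ
ω^-↠-linked s 𝟎 _ _ _ _ _ = ↠𝟎 (ω^ s + 𝟎)
ω^-↠-linked {suc q} s (ω^ g + τ) 1≤q w above linked len≤q =
  ↠-ω^ 1≤q (above here) ◅◅ ω^-sucₒ-↠ g ◅◅
  ↠-ω^+ g (ω^·-↠-linked g q τ 1≤q (n≤1+n q) (wf-tail w) (wf-lead w)
                       (λ m → linked here (there m)) (linked-tail linked) (≤-pred len≤q))

<ₒ-squeeze : ∀ {a p a₂ t r} → ω^ a + p <ₒ ω^ a₂ + t → ω^ a₂ + t <ₒ ω^ a + r → a₂ ≡ a × p <ₒ t × t <ₒ r
<ₒ-squeeze lo hi with <ₒ-ω^⁻ lo | <ₒ-ω^⁻ hi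
... | inj₁ a<a₂ | inj₁ a₂<a = ⊥-elim (<ₒ-asym a<a₂ a₂<a)
... | inj₁ a<a₂ | inj₂ (refl , _) = ⊥-elim (<ₒ-irrefl a<a₂)
... | inj₂ (refl , _) | inj₁ a₂<a = ⊥-elim (<ₒ-irrefl a₂<a)
... | inj₂ (refl , p<t) | inj₂ (_ , t<r) = refl , p<t , t<r

size-ω^·-< : ∀ c k t → WF t → LeadLE t c → ω^ c · k <ₒ t → size (ω^ c · k) < size t
size-ω^·-< c k 𝟎 _ _ c·k<t = ⊥-elim (≮𝟎 c·k<t)
size-ω^·-< c zero (ω^ _ + _) _ _ _ = s≤s z≤n
size-ω^·-< c (suc k) (ω^ c₂ + t) w l c·k<t with <ₒ-ω^⁻ c·k<t
... | inj₁ c<c₂ = ⊥-elim (<ₒ-irrefl (<ₒ-≼-trans c<c₂ (≤ₒ⇒≼ {c₂} {c} l)))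
... | inj₂ (refl , p) = s≤s (+-monoʳ-< (size c) (size-ω^·-< c k t (wf-tail w) (wf-lead w) p))

size-fs-lim-< : ∀ b x t → WF b → WF t → kind b ≡ limK → fs b x <ₒ t → t <ₒ b → size (fs b x) < size t
size-fs-lim-< b x 𝟎 _ _ _ lo _ = ⊥-elim (≮𝟎 lo)
size-fs-lim-< (ω^ a + b@(ω^ _ + _)) x (ω^ a₂ + t) wb wt lim lo hi with <ₒ-squeeze lo hi
... | refl , lo′ , hi′ =
  s≤s (+-monoʳ-< (size a)
    (size-fs-lim-< b x t (wf-tail wb) (wf-tail wt) (kind-ω^+-limK a b tt lim) lo′ hi′))
size-fs-lim-< (ω^ a + 𝟎) x (ω^ a₂ + t) wb wt lim lo hi with <ₒ-ω^⁻ hi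
... | inj₂ (_ , t<𝟎) = ⊥-elim (≮𝟎 t<𝟎)
... | inj₁ a₂<a =
  subst (λ γ → size γ < size (ω^ a₂ + t)) (sym (fs-ω^ a x))
        (byKind (kind a) refl (subst (_<ₒ ω^ a₂ + t) (fs-ω^ a x) lo))
  where
  byKind : ∀ k → kind a ≡ k → fsω^ k a x <ₒ ω^ a₂ + t → size (fsω^ k a x) < size (ω^ a₂ + t)
  byKind zeroK e _ with subst (λ c → kind (ω^ c + 𝟎) ≡ limK) (kind≡zeroK⇒≡𝟎 a e) lim
  ... | ()
  byKind (succK g) e lo′ = ω^·-size x lo′
    where
    a₂≼g : a₂ ≼ g
    a₂≼g = <ₒ-sucₒ⇒≼ a₂ g (subst (a₂ <ₒ_) (kind≡succK⇒≡sucₒ a e) a₂<a)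
    ω^·-size : ∀ x → ω^ g · x <ₒ ω^ a₂ + t → size (ω^ g · x) < size (ω^ a₂ + t)
    ω^·-size zero _ = s≤s z≤n
    ω^·-size (suc x) lo″ with <ₒ-ω^⁻ lo″
    ... | inj₁ g<a₂ = ⊥-elim (<ₒ-irrefl (<ₒ-≼-trans g<a₂ a₂≼g))
    ... | inj₂ (refl , p) = s≤s (+-monoʳ-< (size g) (size-ω^·-< g x t (wf-tail wt) (wf-lead wt) p))
  byKind limK e lo′ with <ₒ-ω^⁻ lo′
  ... | inj₁ p = s≤s (+-mono-<-≤ (size-fs-lim-< a x a₂ (wf-head wb) (wf-head wt) e p a₂<a) z≤n)
  ... | inj₂ (refl , 𝟎<t) = s≤s (+-monoʳ-< (size (fs a x)) (size-nonzero 𝟎<t))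
    where
    size-nonzero : ∀ {t} → 𝟎 <ₒ t → 0 < size t
    size-nonzero {𝟎} 𝟎<𝟎 = ⊥-elim (≮𝟎 𝟎<𝟎)
    size-nonzero {ω^ _ + _} _ = s≤s z≤n

sucₒ-<ₒ-lim : ∀ {t b} → kind b ≡ limK → t <ₒ b → sucₒ t <ₒ b
sucₒ-<ₒ-lim {t} {b} lim t<b with <ₒ⇒sucₒ≼ t b t<b
... | inj₁ t+1<b = t+1<b
... | inj₂ refl with trans (sym (kind-sucₒ t)) lim
... | ()

∈-fs-ω^⇒<ₒ : ∀ b x {t} → t ∈ₒ fs (ω^ b + 𝟎) x → t <ₒ b
∈-fs-ω^⇒<ₒ b x {t} m = byKind (kind b) refl (subst (t ∈ₒ_) (fs-ω^ b x) m)
  where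
  byKind : ∀ k → kind b ≡ k → t ∈ₒ fsω^ k b x → t <ₒ b
  byKind (succK g) e m′ rewrite ∈-ω^· x m′ = subst (g <ₒ_) (sym (kind≡succK⇒≡sucₒ b e)) (<ₒ-sucₒ g)
  byKind limK e here = fs-<ₒ b x (kind≡limK⇒nonZero b e)

↠-uncons : ∀ {q δ γ} → δ ↠[ q ] γ → δ ≢ γ → fs δ q ↠[ q ] γ
↠-uncons ε δ≢γ = ⊥-elim (δ≢γ refl)
↠-uncons (fs-step ◅ d) _ = d

size-nonZero : ∀ μ → NonZeroₒ μ → 1 ≤ size μ
size-nonZero (ω^ _ + _) _ = s≤s z≤n

head-∈ : ∀ μ → NonZeroₒ μ → Σ Ord (_∈ₒ μ)
head-∈ (ω^ t + _) _ = t , here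

LeadLE-∈ : ∀ μ {c} → (∀ {t} → t ∈ₒ μ → t ≼ c) → LeadLE μ c
LeadLE-∈ 𝟎 _ = tt
LeadLE-∈ (ω^ t + _) {c} μ≼c = ≼⇒≤ₒ {t} {c} (μ≼c here)

module _ {b μ x y} (wb : WF b) (wμ : WF μ) (μ≢𝟎 : NonZeroₒ μ) (μ<b : ∀ {t} → t ∈ₒ μ → t <ₒ b)
         (1≤x : 1 ≤ x) (x+μ≤y : x + size μ ≤ y) where

  private
    1≤size-μ : 1 ≤ size μ
    1≤size-μ = size-nonZero μ μ≢𝟎

    size-μ<y : size μ < y
    size-μ<y = <-≤-trans (subst (size μ <_) (+-comm (size μ) x) (m<m+n (size μ) 1≤x)) x+μ≤y

    1≤y : 1 ≤ y
    1≤y = ≤-trans 1≤size-μ (<⇒≤ size-μ<y)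

    2≤y : 2 ≤ y
    2≤y = ≤-trans (+-mono-≤ 1≤x 1≤size-μ) x+μ≤y

    x<y : x < y
    x<y = <-≤-trans (subst (_< x + size μ) (+-identityʳ x) (+-monoʳ-< x 1≤size-μ)) x+μ≤y

    size-∈μ : ∀ {t} → t ∈ₒ μ → size t + 1 < y
    size-∈μ m = ≤-<-trans (subst (_≤ size μ) (+-comm 1 _) (size-∈ m)) size-μ<y

    ↠-sucₒ-∈μ : ∀ {s t} → t ∈ₒ μ → t <ₒ s → s ↠[ y ] sucₒ t
    ↠-sucₒ-∈μ {s} {t} m t<s = ↠-sucₒ s t (wf-∈ wμ m) t<s (size-∈μ m)

    length≤y : ∀ {n} → n ≤ x → n + lengthₒ μ ≤ y
    length≤y n≤x = ≤-trans (+-mono-≤ n≤x (lengthₒ≤size μ)) x+μ≤y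

  fs-ω^-succ-↠ : ∀ {c} → kind b ≡ succK c → ω^ c · y ↠[ y ] (ω^ c · x) ⊕ μ
  fs-ω^-succ-↠ {c} succ =
    ω^·-↠-linked c y τ 1≤y ≤-refl wτ (LeadLE-⊕ (ω^ c · x) μ (LeadLE-ω^· c x) lead-μ)
                 below linked len-τ
    where
    τ : Ord
    τ = (ω^ c · x) ⊕ μ
    b≡c+1 : b ≡ sucₒ c
    b≡c+1 = kind≡succK⇒≡sucₒ b succ
    μ≼c : ∀ {t} → t ∈ₒ μ → t ≼ c
    μ≼c m = <ₒ-sucₒ⇒≼ _ c (subst (_ <ₒ_) b≡c+1 (μ<b m))
    lead-μ : LeadLE μ c
    lead-μ = LeadLE-∈ μ μ≼c
    wτ : WF τ
    wτ = wf-⊕ (ω^ c · x) μ (wf-ω^· c x (wf-++ₒ⁻ˡ c 𝟏 (subst WF b≡c+1 wb))) wμ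
    below : ∀ {t} → t ∈ₒ τ → t <ₒ c → c ↠[ y ] sucₒ t
    below m t<c with ∈-⊕⁻ (ω^ c · x) μ m
    ... | inj₁ mc = ⊥-elim (<ₒ-irrefl′ (∈-ω^· x mc) t<c)
    ... | inj₂ mμ = ↠-sucₒ-∈μ mμ t<c
    linked : Linked y τ
    linked mt mt′ t′<t with ∈-⊕⁻ (ω^ c · x) μ mt′ | ∈-⊕⁻ (ω^ c · x) μ mt
    ... | inj₂ mμ′ | _ = ↠-sucₒ-∈μ mμ′ t′<t
    ... | inj₁ mc′ | inj₁ mc = ⊥-elim (<ₒ-irrefl′ (trans (∈-ω^· x mc′) (sym (∈-ω^· x mc))) t′<t)
    ... | inj₁ mc′ | inj₂ mμ =
      ⊥-elim (<ₒ-irrefl (≼-<ₒ-trans (μ≼c mμ) (subst (_<ₒ _) (∈-ω^· x mc′) t′<t)))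
    len-τ : lengthₒ τ ≤ y
    len-τ = subst (_≤ y)
                  (sym (trans (lengthₒ-⊕ (ω^ c · x) μ) (cong (_+ lengthₒ μ) (lengthₒ-ω^· c x))))
                  (length≤y ≤-refl)

  fs-ω^-lim-↠ : kind b ≡ limK → ω^ fs b y + 𝟎 ↠[ y ] (ω^ fs b x + 𝟎) ⊕ μ
  fs-ω^-lim-↠ lim = ω^-↠-linked (fs b y) τ 1≤y wτ above linked len-τ
    where
    f τ : Ord
    f = fs b x
    τ = (ω^ f + 𝟎) ⊕ μ
    wf-f : WF f
    wf-f = wf-fs b x wb
    wτ : WF τ
    wτ = wf-⊕ (ω^ f + 𝟎) μ (wfω wf-f wf𝟎 tt) wμ
    above : ∀ {t} → t ∈ₒ τ → fs b y ↠[ y ] sucₒ t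
    above m with ∈-⊕⁻ (ω^ f + 𝟎) μ m
    ... | inj₁ here = fs-↠-sucₒ-fs 2≤y b lim x<y
    ... | inj₂ mμ = ↠-uncons (↠-sucₒ-∈μ mμ (μ<b mμ))
                             (λ b≡t+1 → <ₒ-irrefl′ (sym b≡t+1) (sucₒ-<ₒ-lim lim (μ<b mμ)))
    linked : Linked y τ
    linked {t} mt mt′ t′<t with ∈-⊕⁻ (ω^ f + 𝟎) μ mt′ | ∈-⊕⁻ (ω^ f + 𝟎) μ mt
    ... | inj₂ mμ′ | _ = ↠-sucₒ-∈μ mμ′ t′<t
    ... | inj₁ here | inj₁ here = ⊥-elim (<ₒ-irrefl t′<t)
    ... | inj₁ here | inj₂ mμ =
      ↠-sucₒ t f wf-f t′<t
        (≤-<-trans (subst (_≤ size t) (+-comm 1 (size f))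
                          (size-fs-lim-< b x t wb (wf-∈ wμ mμ) lim t′<t (μ<b mμ)))
                   (<-trans (size-∈ mμ) size-μ<y))
    len-τ : lengthₒ τ ≤ y
    len-τ = subst (_≤ y) (sym (lengthₒ-⊕ (ω^ f + 𝟎) μ)) (length≤y 1≤x)

  fs-ω^-↠-fs-ω^-⊕ : fs (ω^ b + 𝟎) y ↠[ y ] fs (ω^ b + 𝟎) x ⊕ μ
  fs-ω^-↠-fs-ω^-⊕ =
    subst₂ _↠[ y ]_ (sym (fs-ω^ b y)) (cong (_⊕ μ) (sym (fs-ω^ b x))) (byKind (kind b) refl)
    where
    byKind : ∀ k → kind b ≡ k → fsω^ k b y ↠[ y ] fsω^ k b x ⊕ μ
    byKind zeroK e = ⊥-elim (≮𝟎 (subst (_ <ₒ_) (kind≡zeroK⇒≡𝟎 b e) (μ<b (proj₂ (head-∈ μ μ≢𝟎)))))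
    byKind (succK c) e = fs-ω^-succ-↠ e
    byKind limK e = fs-ω^-lim-↠ e

-- Splitting β ⊕ α at the last term of β

last-term : ∀ β → NonZeroₒ β → WF β →
            Σ Ord λ β₀ → Σ Ord λ b → β ≡ β₀ ++ₒ (ω^ b + 𝟎) × WF b × (∀ {t} → t ∈ₒ β₀ → b ≼ t)
last-term (ω^ a + 𝟎) _ w = 𝟎 , a , refl , wf-head w , λ ()
last-term (ω^ a + β@(ω^ _ + _)) _ w with last-term β tt (wf-tail w)
... | β₀ , b , β≡ , wb , b≼β₀ = ω^ a + β₀ , b , cong (ω^ a +_) β≡ , wb , b≼
  where
  b≼ : ∀ {t} → t ∈ₒ ω^ a + β₀ → b ≼ t
  b≼ here = ∈-≼-head w (there (subst (b ∈ₒ_) (sym β≡) (∈-++ₒ⁺ʳ β₀ here)))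
  b≼ (there m) = b≼β₀ m

split-above : ∀ b α → WF α → Σ Ord λ hi → Σ Ord λ lo →
              α ≡ hi ++ₒ lo × (∀ {t} → t ∈ₒ hi → b <ₒ t) × (∀ {t} → t ∈ₒ lo → t ≼ b)
split-above b 𝟎 _ = 𝟎 , 𝟎 , refl , (λ ()) , (λ ())
split-above b (ω^ t + r) w with <ₒ-or-≽ b t
... | inj₂ t≼b = 𝟎 , ω^ t + r , refl , (λ ()) , (λ m → ≼-trans (∈-≼-head w m) t≼b)
... | inj₁ b<t with split-above b r (wf-tail w)
...   | hi , lo , r≡ , b<hi , lo≼b = ω^ t + hi , lo , cong (ω^ t +_) r≡ , b< , lo≼b
  where
  b< : ∀ {s} → s ∈ₒ ω^ t + hi → b <ₒ s
  b< here = b<t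
  b< (there m) = b<hi m

split-copies : ∀ b lo → WF lo → (∀ {t} → t ∈ₒ lo → t ≼ b) →
               Σ ℕ λ k → Σ Ord λ μ → lo ≡ (ω^ b · k) ++ₒ μ × WF μ × (∀ {t} → t ∈ₒ μ → t <ₒ b)
split-copies b 𝟎 _ _ = 0 , 𝟎 , refl , wf𝟎 , λ ()
split-copies b (ω^ t + r) w lo≼b with lo≼b here
... | inj₁ t<b = 0 , ω^ t + r , refl , w , λ m → ≼-<ₒ-trans (∈-≼-head w m) t<b
... | inj₂ refl with split-copies t r (wf-tail w) (λ m → lo≼b (there m))
...   | k , μ , r≡ , wμ , μ<b = suc k , μ , cong (ω^ t +_) r≡ , wμ , μ<b

record ⊕-Split (β α : Ord) : Set where
  field
    Γ b μ : Ord
    k : ℕ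
    wf-b : WF b
    wf-μ : WF μ
    μ<b : ∀ {t} → t ∈ₒ μ → t <ₒ b
    β⊕α≡ : β ⊕ α ≡ Γ ++ₒ ((ω^ b · k) ++ₒ (ω^ b + μ))
    fsβ⊕α≡ : ∀ x → fs β x ⊕ α ≡ Γ ++ₒ ((ω^ b · k) ++ₒ (fs (ω^ b + 𝟎) x ⊕ μ))

⊕-split : ∀ β α → NonZeroₒ β → WF β → WF α → ⊕-Split β α
⊕-split β α β≢𝟎 wβ wα with last-term β β≢𝟎 wβ
... | β₀ , b , β≡ , wb , b≼β₀ with split-above b α wα
... | hi , lo , α≡ , b<hi , lo≼b with split-copies b lo (wf-++ₒ⁻ʳ hi lo (subst WF α≡ wα)) lo≼b
... | k , μ , lo≡ , wμ , μ<b = record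
  { Γ = β₀ ⊕ hi ; b = b ; μ = μ ; k = k ; wf-b = wb ; wf-μ = wμ ; μ<b = μ<b
  ; β⊕α≡ = β⊕α≡ ; fsβ⊕α≡ = fsβ⊕α≡ }
  where
  open ≡-Reasoning
  β₀≽lo : β₀ ≽ᵗ lo
  β₀≽lo mt ms = ≼-trans (lo≼b ms) (b≼β₀ mt)
  ω^b≽lo : ω^ b + 𝟎 ≽ᵗ lo
  ω^b≽lo here ms = lo≼b ms
  hi≻ω^b : hi ≻ᵗ ω^ b + 𝟎
  hi≻ω^b mt here = b<hi mt
  β⊕α≡ : β ⊕ α ≡ (β₀ ⊕ hi) ++ₒ ((ω^ b · k) ++ₒ (ω^ b + μ))
  β⊕α≡ = begin
    β ⊕ α                                        ≡⟨ cong₂ _⊕_ β≡ α≡ ⟩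
    (β₀ ++ₒ (ω^ b + 𝟎)) ⊕ (hi ++ₒ lo)            ≡⟨ ⊕-++ₒ β₀ (ω^ b + 𝟎) hi lo β₀≽lo hi≻ω^b ⟩
    (β₀ ⊕ hi) ++ₒ ((ω^ b + 𝟎) ⊕ lo)              ≡⟨ cong ((β₀ ⊕ hi) ++ₒ_) (⊕-++ₒˡ (ω^ b + 𝟎) 𝟎 lo ω^b≽lo) ⟩
    (β₀ ⊕ hi) ++ₒ (ω^ b + lo)                    ≡⟨ cong (λ ξ → (β₀ ⊕ hi) ++ₒ (ω^ b + ξ)) lo≡ ⟩
    (β₀ ⊕ hi) ++ₒ (ω^ b + ((ω^ b · k) ++ₒ μ))    ≡⟨ cong ((β₀ ⊕ hi) ++ₒ_) (ω^+-ω^· b k μ) ⟩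
    (β₀ ⊕ hi) ++ₒ ((ω^ b · k) ++ₒ (ω^ b + μ))    ∎
  fsβ⊕α≡ : ∀ x → fs β x ⊕ α ≡ (β₀ ⊕ hi) ++ₒ ((ω^ b · k) ++ₒ (fs (ω^ b + 𝟎) x ⊕ μ))
  fsβ⊕α≡ x = begin
    fs β x ⊕ α                                   ≡⟨ cong₂ _⊕_ fsβ≡ α≡ ⟩
    (β₀ ++ₒ E) ⊕ (hi ++ₒ lo)                     ≡⟨ ⊕-++ₒ β₀ E hi lo β₀≽lo hi≻E ⟩
    (β₀ ⊕ hi) ++ₒ (E ⊕ lo)                       ≡⟨ cong (λ ξ → (β₀ ⊕ hi) ++ₒ (E ⊕ ξ)) lo≡ ⟩
    (β₀ ⊕ hi) ++ₒ (E ⊕ ((ω^ b · k) ++ₒ μ))       ≡⟨ cong ((β₀ ⊕ hi) ++ₒ_) (⊕-++ₒʳ E (ω^ b · k) μ ω^b·k≻E) ⟩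
    (β₀ ⊕ hi) ++ₒ ((ω^ b · k) ++ₒ (E ⊕ μ))       ∎
    where
    E : Ord
    E = fs (ω^ b + 𝟎) x
    fsβ≡ : fs β x ≡ β₀ ++ₒ E
    fsβ≡ = trans (cong (λ γ → fs γ x) β≡) (fs-++ₒ β₀ (ω^ b + 𝟎) x tt)
    hi≻E : hi ≻ᵗ E
    hi≻E mt ms = <ₒ-trans (∈-fs-ω^⇒<ₒ b x ms) (b<hi mt)
    ω^b·k≻E : ω^ b · k ≻ᵗ E
    ω^b·k≻E mt ms = subst (_ <ₒ_) (sym (∈-ω^· k mt)) (∈-fs-ω^⇒<ₒ b x ms)

-- The Hardy hierarchy

module _ (h : PFun) (expansive : Expansive h) where

  infix 4 _⇝_
  _⇝_ : ℕ → ℕ → Set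
  _⇝_ = Star (λ u v → h u ≡ just v)

  h-functional : ∀ {u v w} → h u ≡ just v → h u ≡ just w → v ≡ w
  h-functional e e′ = just-injective (trans (sym e) e′)

  ⇝⇒≤ : ∀ {u v} → u ⇝ v → u ≤ v
  ⇝⇒≤ ε = ≤-refl
  ⇝⇒≤ (e ◅ r) = ≤-trans (<⇒≤ (expansive _ _ e)) (⇝⇒≤ r)

  ⇝-between : ∀ {u v w} → u ⇝ v → u ⇝ w → v ≤ w → v ⇝ w
  ⇝-between ε r _ = r
  ⇝-between (e ◅ r) ε v≤u = ⊥-elim (<-irrefl refl (<-≤-trans (expansive _ _ e) (≤-trans (⇝⇒≤ r) v≤u)))
  ⇝-between (e ◅ r) (e′ ◅ r′) v≤w rewrite h-functional e e′ = ⇝-between r r′ v≤w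

  ⇝-next : ∀ {u v w} → u ⇝ v → h v ≡ just w → Σ ℕ λ hu → h u ≡ just hu × hu ⇝ w
  ⇝-next ε e = _ , e , ε
  ⇝-next (e ◅ r) e′ = _ , e , r ◅◅ (e′ ◅ ε)

  hardy-⇝ : ∀ {γ u w} → Hardy h γ u w → u ⇝ w
  hardy-⇝ (hardy𝟎 _) = ε
  hardy-⇝ (hardyω e d) = e ◅ hardy-⇝ d

  hardy-≤ : ∀ {γ u w} → Hardy h γ u w → u ≤ w
  hardy-≤ d = ⇝⇒≤ (hardy-⇝ d)

  hardy-𝟎⁻ : ∀ {u z} → Hardy h 𝟎 u z → u ≡ z
  hardy-𝟎⁻ (hardy𝟎 _) = refl

  hardy-unfold : ∀ γ {u z} → NonZeroₒ γ → Hardy h γ u z →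
                 Σ ℕ λ hu → h u ≡ just hu × Hardy h (fs γ u) hu z
  hardy-unfold (ω^ _ + _) _ (hardyω e d) = _ , e , d

  hardy-fold : ∀ γ {u hu z} → NonZeroₒ γ → h u ≡ just hu → Hardy h (fs γ u) hu z → Hardy h γ u z
  hardy-fold (ω^ _ + _) _ = hardyω

  hardy-++ₒ⁻ : ∀ ρ σ {u w} → Hardy h (ρ ++ₒ σ) u w → Σ ℕ λ v → Hardy h σ u v × Hardy h ρ v w
  hardy-++ₒ⁻ ρ σ d = split σ d refl
    where
    split : ∀ σ {γ u w} → Hardy h γ u w → γ ≡ ρ ++ₒ σ → Σ ℕ λ v → Hardy h σ u v × Hardy h ρ v w
    split 𝟎 {u = u} d γ≡ρ = u , hardy𝟎 u , subst (λ γ → Hardy h γ u _) (trans γ≡ρ (++ₒ-identityʳ ρ)) d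
    split (ω^ _ + _) (hardy𝟎 u) 𝟎≡ρσ = ⊥-elim (subst NonZeroₒ (sym 𝟎≡ρσ) (++ₒ-nonZero ρ tt))
    split σ@(ω^ _ + _) {u = u} (hardyω e d) γ≡ρσ
      with split (fs σ u) d (trans (cong (λ γ → fs γ u) γ≡ρσ) (fs-++ₒ ρ σ u tt))
    ... | v , dσ , dρ = v , hardyω e dσ , dρ

  hardy-++ₒ⁺ : ∀ {ρ σ u v w} → Hardy h σ u v → Hardy h ρ v w → Hardy h (ρ ++ₒ σ) u w
  hardy-++ₒ⁺ {ρ} (hardy𝟎 u) dρ = subst (λ γ → Hardy h γ u _) (sym (++ₒ-identityʳ ρ)) dρ
  hardy-++ₒ⁺ {ρ} {σ} {u} (hardyω e dσ) dρ =
    hardy-fold (ρ ++ₒ σ) (++ₒ-nonZero ρ tt) e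
      (subst (λ γ → Hardy h γ _ _) (sym (fs-++ₒ ρ σ u tt)) (hardy-++ₒ⁺ dσ dρ))

  hardy-size : ∀ {γ u w} → 1 ≤ u → Hardy h γ u w → u + size γ ≤ w
  hardy-size {u = u} _ (hardy𝟎 _) = ≤-reflexive (+-identityʳ u)
  hardy-size {γ} {u} 1≤u (hardyω {hx = hu} e d) = begin
    u + size γ                 ≤⟨ +-monoʳ-≤ u (size-fs γ tt 1≤u) ⟩
    u + suc (size (fs γ u))    ≡⟨ +-suc u _ ⟩
    suc u + size (fs γ u)      ≤⟨ +-monoˡ-≤ _ u<hu ⟩
    hu + size (fs γ u)         ≤⟨ hardy-size (≤-trans 1≤u (<⇒≤ u<hu)) d ⟩
    _                          ∎
    where
    open ≤-Reasoning
    u<hu : u < hu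
    u<hu = expansive u hu e

  Hardy≤ : Ord → ℕ → ℕ → Set
  Hardy≤ γ u z = Σ ℕ λ w → Hardy h γ u w × w ≤ z

  private
    refuel : ∀ n {u v z} → z ≤ suc n + u → u < v → z ≤ n + v
    refuel n {u} z≤ u<v = ≤-trans z≤ (≤-trans (≤-reflexive (sym (+-suc n u))) (+-monoʳ-≤ n u<v))

    no-fuel : ∀ γ {u z} → NonZeroₒ γ → z ≤ 0 + u → ¬ Hardy h γ u z
    no-fuel γ γ≢𝟎 z≤u d with hardy-unfold γ γ≢𝟎 d
    ... | hu , e , d′ = <-irrefl refl (<-≤-trans (expansive _ hu e) (≤-trans (hardy-≤ d′) z≤u))

    -- The fuel n with z ≤ n + u bounds the number of h-steps, as each one raises u.
    mutual
      ⇝-mono′ : ∀ n γ {u v z} → z ≤ n + v → 1 ≤ u → u ⇝ v → Hardy h γ v z → Hardy≤ γ u z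
      ⇝-mono′ n 𝟎 {u} _ _ r d rewrite sym (hardy-𝟎⁻ d) = u , hardy𝟎 u , ⇝⇒≤ r
      ⇝-mono′ zero γ@(ω^ _ + _) fuel _ _ d = ⊥-elim (no-fuel γ tt fuel d)
      ⇝-mono′ (suc n) γ@(ω^ _ + _) {u} {v} fuel 1≤u r (hardyω {hx = hv} e d)
        with ⇝-next r e
      ... | hu , eu , r′
        with ↠-mono′ n (fs γ v) (fs γ u) (refuel n fuel v<hv) 1≤u (≤-trans (⇝⇒≤ r) (<⇒≤ v<hv))
                     (fs-↠-fs 1≤u γ (⇝⇒≤ r)) d
        where
          v<hv : v < hv
          v<hv = expansive v hv e
      ... | w₁ , d₁ , w₁≤z
        with ⇝-mono′ n (fs γ u) (≤-trans w₁≤z (refuel n fuel (expansive v hv e)))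
                     (≤-trans 1≤u (<⇒≤ (expansive u hu eu))) r′ d₁
      ... | w₂ , d₂ , w₂≤w₁ = w₂ , hardyω eu d₂ , ≤-trans w₂≤w₁ w₁≤z

      ↠-mono′ : ∀ n δ γ {p u z} → z ≤ n + u → 1 ≤ p → p ≤ u → δ ↠[ p ] γ → Hardy h δ u z →
                Hardy≤ γ u z
      ↠-mono′ n δ .δ {z = z} _ _ _ ε d = z , d , ≤-refl
      ↠-mono′ zero δ γ fuel _ _ (fs-step ◅ _) d = ⊥-elim (no-fuel δ tt fuel d)
      ↠-mono′ (suc n) δ γ {p} {u} fuel 1≤p p≤u (fs-step ◅ r) (hardyω {hx = hu} e d)
        with ↠-mono′ n (fs δ u) γ (refuel n fuel u<hu) 1≤p (≤-trans p≤u (<⇒≤ u<hu))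
                     (fs-↠-fs 1≤p δ p≤u ◅◅ r) d
        where
          u<hu : u < hu
          u<hu = expansive u hu e
      ... | w₁ , d₁ , w₁≤z
        with ⇝-mono′ n γ (≤-trans w₁≤z (refuel n fuel (expansive u hu e))) (≤-trans 1≤p p≤u) (e ◅ ε) d₁
      ... | w₂ , d₂ , w₂≤w₁ = w₂ , d₂ , ≤-trans w₂≤w₁ w₁≤z

  hardy-⇝-mono : ∀ γ {u v z} → 1 ≤ u → u ⇝ v → Hardy h γ v z → Hardy≤ γ u z
  hardy-⇝-mono γ {v = v} {z} = ⇝-mono′ z γ (m≤m+n z v)

  hardy-↠-mono : ∀ δ γ {p u z} → 1 ≤ p → p ≤ u → δ ↠[ p ] γ → Hardy h δ u z → Hardy≤ γ u z
  hardy-↠-mono δ γ {u = u} {z} = ↠-mono′ z δ γ (m≤m+n z u)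

  hardy-prefix-mono : ∀ ρ σ σ′ {x x′ z} → 1 ≤ x′ → x ⇝ x′ → Hardy h (ρ ++ₒ σ) x z →
                      (∀ {m} → Hardy h σ x m → Hardy≤ σ′ x′ m) → Hardy≤ (ρ ++ₒ σ′) x′ z
  hardy-prefix-mono ρ σ σ′ 1≤x′ x⇝x′ d σ⇒σ′ with hardy-++ₒ⁻ ρ σ d
  ... | m , dσ , dρ with σ⇒σ′ dσ
  ...   | w , dσ′ , w≤m with hardy-⇝-mono ρ (≤-trans 1≤x′ (hardy-≤ dσ′))
                                         (⇝-between (x⇝x′ ◅◅ hardy-⇝ dσ′) (hardy-⇝ dσ) w≤m) dρ
  ...     | w′ , dρ′ , w′≤z = w′ , hardy-++ₒ⁺ dσ′ dρ′ , w′≤z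

  hardy-ω^+-fs : ∀ b μ {x hx m} → WF b → WF μ → (∀ {t} → t ∈ₒ μ → t <ₒ b) → 1 ≤ x → h x ≡ just hx →
                 Hardy h (ω^ b + μ) x m → Hardy≤ (fs (ω^ b + 𝟎) x ⊕ μ) hx m
  hardy-ω^+-fs b 𝟎 {x} {hx} {m} _ _ _ _ e (hardyω e′ d)
    rewrite h-functional e e′ | ⊕-identityʳ (fs (ω^ b + 𝟎) x) = m , d , ≤-refl
  hardy-ω^+-fs b μ@(ω^ _ + _) {x} {hx} wb wμ μ<b 1≤x e d
    with hardy-++ₒ⁻ (ω^ b + 𝟎) μ d
  ... | y , dμ , hardyω {hx = hy} ey dω^b
    with hardy-↠-mono (fs (ω^ b + 𝟎) y) (fs (ω^ b + 𝟎) x ⊕ μ) 1≤y (<⇒≤ (expansive y hy ey))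
                      (fs-ω^-↠-fs-ω^-⊕ wb wμ tt μ<b 1≤x (hardy-size 1≤x dμ)) dω^b
    where
      1≤y : 1 ≤ y
      1≤y = ≤-trans 1≤x (hardy-≤ dμ)
  ... | w , dw , w≤m with ⇝-next (hardy-⇝ dμ) ey
  ... | hx′ , e′ , hx′⇝hy rewrite h-functional e e′
    with hardy-⇝-mono (fs (ω^ b + 𝟎) x ⊕ μ) (≤-trans 1≤x (<⇒≤ (expansive x hx′ e′))) hx′⇝hy dw
  ... | w′ , dw′ , w′≤w = w′ , dw′ , ≤-trans w′≤w w≤m

  hardy-fs-⊕ : ∀ β α {x hx z} → NonZeroₒ β → WF β → WF α → 1 ≤ x → h x ≡ just hx →
               Hardy h (β ⊕ α) x z → Hardy≤ (fs β x ⊕ α) hx z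
  hardy-fs-⊕ β α {x} {hx} {z} β≢𝟎 wβ wα 1≤x e d =
    subst (λ γ → Hardy≤ γ hx z) (sym (fsβ⊕α≡ x))
      (hardy-prefix-mono Γ _ _ 1≤hx (e ◅ ε) (subst (λ γ → Hardy h γ x z) β⊕α≡ d) λ dσ →
        hardy-prefix-mono (ω^ b · k) _ _ 1≤hx (e ◅ ε) dσ (hardy-ω^+-fs b μ wf-b wf-μ μ<b 1≤x e))
    where
    open ⊕-Split (⊕-split β α β≢𝟎 wβ wα)
    1≤hx : 1 ≤ hx
    1≤hx = ≤-trans 1≤x (<⇒≤ (expansive x hx e))

mainTheorem3 : (h : PFun) → Increasing h → Expansive h →
    (α β : Ord) → WF α → WF β → β ≢ 𝟎 →
    (x : ℕ) → 0 < x →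
    (z : ℕ) → Hardy h (β ⊕ α) x z →
    Σ ℕ (λ hx → h x ≡ just hx ×
      (Hardy h (fs (β ⊕ α) x) hx z ×
       Σ ℕ (λ w → Hardy h (fs β x ⊕ α) hx w × w ≤ z)))
mainTheorem3 h _ expansive α β wα wβ β≢𝟎 x 0<x z d
  with hardy-unfold h expansive (β ⊕ α) (⊕-nonZero β α (≢𝟎⇒nonZero β≢𝟎)) d
... | hx , e , d′ = hx , e , d′ , hardy-fs-⊕ h expansive β α (≢𝟎⇒nonZero β≢𝟎) wβ wα 0<x e d
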